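{- Let $P$, $Q$, $R$ be Interface Automata with common input alphabet $I$ and common output alphabet $O$, such that $R$ has a state set disjoint from those of $P$ and of $Q$, and let $p\in P$, $q\in Q$, $r\in R$. If $p\sqsubseteq_{\mathrm{IA}} q$, then $p\vee r\sqsubseteq_{\mathrm{IA}} q\vee r$ (states of the IA-disjunctions $P\vee R$ and $Q\vee R$, respectively).
   Context: An Interface Automaton (IA) is a tuple $P=(P,I,O,\rightarrow_P)$ where $P$ is a set of states, $I$ and $O$ are disjoint sets of input and output actions not containing the special silent action $\tau$, and $\rightarrow_P\subseteq P\times(I\cup O\cup\{\tau\})\times P$ is input-deterministic: for $a\in I$, $p\xrightarrow{a}p'$ and $p\xrightarrow{a}p''$ imply $p'=p''$. Weak transitions: $p\stackrel{\epsilon}{\Rightarrow}p'$ iff $p(\xrightarrow{\tau})^*p'$; for $o\in O$, $p\stackrel{o}{\Rightarrow}p'$ iff there is $p''$ with $p\stackrel{\epsilon}{\Rightarrow}p''\xrightarrow{o}p'$; $\hat\alpha=\epsilon$ if $\alpha=\tau$ and $\hat\alpha=\alpha$ otherwise. For IAs $P,Q$ with the same alphabets, $\mathcal R\subseteq P\times Q$ is an alternating simulation if for all $(p,q)\in\mathcal R$: (i) $q\xrightarrow{a}q'$ with $a\in I$ implies some $p'$ with $p\xrightarrow{a}p'$ and $(p',q')\in\mathcal R$; (ii) $p\xrightarrow{\alpha}p'$ with $\alpha\in O\cup\{\tau\}$ implies some $q'$ with $q\stackrel{\hat\alpha}{\Rightarrow}q'$ and $(p',q')\in\mathcal R$. Write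 $p\sqsubseteq_{\mathrm{IA}}q$ if some alternating simulation contains $(p,q)$. IA-disjunction: for IAs $P,Q$ with common alphabets and disjoint state sets, $P\vee Q$ has state set $\{p\vee q: p\in P,q\in Q\}\cup P\cup Q$, alphabets $I,O$, and the least transition relation containing $\rightarrow_P$, $\rightarrow_Q$ and satisfying: (I) $p\vee q\xrightarrow{a}p'\vee q'$ if $p\xrightarrow{a}_Pp'$, $q\xrightarrow{a}_Qq'$, $a\in I$; (OT1) $p\vee q\xrightarrow{\alpha}p'$ if $p\xrightarrow{\alpha}_Pp'$, $\alpha\in O\cup\{\tau\}$; (OT2) $p\vee q\xrightarrow{\alpha}q'$ if $q\xrightarrow{\alpha}_Qq'$, $\alpha\in O\cup\{\tau\}$. -}

module Defs where

open import Level using (Level; _⊔_; suc)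
open import Data.Product using (Σ; ∃; _×_; _,_)
open import Relation.Binary.PropositionalEquality using (_≡_; cong; cong₂)
open import Relation.Binary.Construct.Closure.ReflexiveTransitive using (Star)

data Act {i o : Level} (I : Set i) (O : Set o) : Set (i ⊔ o) where
  inp : I → Act I O
  out : O → Act I O
  τ   : Act I O

record IA {i o : Level} (s t : Level) (I : Set i) (O : Set o)
       : Set (i ⊔ o ⊔ suc s ⊔ suc t) where
  field
    State  : Set s
    _—[_]→_ : State → Act I O → State → Set t
    input-det : ∀ {p p′ p″} (a : I) →
      p —[ inp a ]→ p′ → p —[ inp a ]→ p″ → p′ ≡ p″

module _ {i o s t : Level} {I : Set i} {O : Set o} (P : IA s t I O) where
  open IA P

  _⇒ε_ : State → State → Set (s ⊔ t)
  _⇒ε_ = Star (λ x y → x —[ τ ]→ y)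

  weak : State → Act I O → State → Set (s ⊔ t)
  weak p (inp a) p′ = Σ State λ p″ → (p ⇒ε p″) × (p″ —[ inp a ]→ p′)
  weak p (out b) p′ = Σ State λ p″ → (p ⇒ε p″) × (p″ —[ out b ]→ p′)
  weak p τ       p′ = p ⇒ε p′

data OutOrτ {i o : Level} {I : Set i} {O : Set o} : Act I O → Set (i ⊔ o) where
  isOut : (b : O) → OutOrτ (out b)
  isτ   : OutOrτ τ

record IsAltSim {i o s₁ t₁ s₂ t₂ r : Level} {I : Set i} {O : Set o}
       (P : IA s₁ t₁ I O) (Q : IA s₂ t₂ I O)
       (𝓡 : IA.State P → IA.State Q → Set r)
       : Set (i ⊔ o ⊔ s₁ ⊔ t₁ ⊔ s₂ ⊔ t₂ ⊔ r) where
  private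
    module P = IA P
    module Q = IA Q
  field
    inputs  : ∀ {p q} → 𝓡 p q → ∀ (a : I) {q′} → q Q.—[ inp a ]→ q′ →
              Σ P.State λ p′ → (p P.—[ inp a ]→ p′) × 𝓡 p′ q′
    outputs : ∀ {p q} → 𝓡 p q → ∀ {α p′} → OutOrτ α → p P.—[ α ]→ p′ →
              Σ Q.State λ q′ → weak Q q α q′ × 𝓡 p′ q′

⊑IA : {i o s₁ t₁ s₂ t₂ : Level} {I : Set i} {O : Set o} →
  (P : IA s₁ t₁ I O) (Q : IA s₂ t₂ I O) →
  IA.State P → IA.State Q → Set (i ⊔ o ⊔ suc (s₁ ⊔ t₁ ⊔ s₂ ⊔ t₂))
⊑IA {s₁ = s₁} {t₁} {s₂} {t₂} P Q p q =
  Σ (IA.State P → IA.State Q → Set (s₁ ⊔ t₁ ⊔ s₂ ⊔ t₂)) λ 𝓡 →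
    IsAltSim P Q 𝓡 × 𝓡 p q

-- IA-disjunction P ∨ Q. Its state set is {p ∨ q} ∪ P ∪ Q, realised as a
-- disjoint union (so the state sets of P and Q are disjoint by construction).
data ∨State {s₁ s₂ : Level} (A : Set s₁) (B : Set s₂) : Set (s₁ ⊔ s₂) where
  _∨_  : A → B → ∨State A B
  left  : A → ∨State A B
  right : B → ∨State A B

module _ {i o s₁ t₁ s₂ t₂ : Level} {I : Set i} {O : Set o}
         (P : IA s₁ t₁ I O) (Q : IA s₂ t₂ I O) where
  private
    module P = IA P
    module Q = IA Q

  data ∨Step : ∨State P.State Q.State → Act I O → ∨State P.State Q.State →
               Set (i ⊔ o ⊔ s₁ ⊔ t₁ ⊔ s₂ ⊔ t₂) where
    stepP : ∀ {p α p′} → p P.—[ α ]→ p′ → ∨Step (left p) α (left p′)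
    stepQ : ∀ {q α q′} → q Q.—[ α ]→ q′ → ∨Step (right q) α (right q′)
    rI    : ∀ {p q p′ q′} (a : I) → p P.—[ inp a ]→ p′ → q Q.—[ inp a ]→ q′ →
            ∨Step (p ∨ q) (inp a) (p′ ∨ q′)
    rOT1  : ∀ {p q α p′} → OutOrτ α → p P.—[ α ]→ p′ →
            ∨Step (p ∨ q) α (left p′)
    rOT2  : ∀ {p q α q′} → OutOrτ α → q Q.—[ α ]→ q′ →
            ∨Step (p ∨ q) α (right q′)

  private
    det : ∀ {x x′ x″} (a : I) → ∨Step x (inp a) x′ → ∨Step x (inp a) x″ → x′ ≡ x″
    det a (stepP s) (stepP s′) = cong left (P.input-det a s s′)
    det a (stepQ s) (stepQ s′) = cong right (Q.input-det a s s′)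
    det a (rI _ s t) (rI _ s′ t′) = cong₂ _∨_ (P.input-det a s s′) (Q.input-det a t t′)
    det a (rI _ _ _) (rOT1 () _)
    det a (rI _ _ _) (rOT2 () _)
    det a (rOT1 () _) _
    det a (rOT2 () _) _

  _∨IA_ : IA (s₁ ⊔ s₂) (i ⊔ o ⊔ s₁ ⊔ t₁ ⊔ s₂ ⊔ t₂) I O
  _∨IA_ = record { State = ∨State P.State Q.State ; _—[_]→_ = ∨Step ; input-det = det }

-- Extend an alternating simulation 𝓡 ⊆ P × Q to the disjunctions by relating
-- p ∨ r to q ∨ r, left p to left q, right r to right r, and additionally
-- left p to q ∨ r. The last pairs are needed because a τ-step p ∨ r —τ→ left p′
-- taken via (OT1) may be answered by the empty τ-path of q ∨ r; from q ∨ r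
-- every answer of q in Q can still be replayed, via (OT1) for its first step.
module Submission where

open import Level using (Level; _⊔_)
open import Data.Product using (Σ; _×_; _,_)
open import Relation.Binary.Construct.Closure.ReflexiveTransitive using (ε; _◅_; gmap)
open import Defs

step⇒weak : ∀ {i o s t} {I : Set i} {O : Set o} (P : IA s t I O) →
  ∀ {p α p′} → IA._—[_]→_ P p α p′ → weak P p α p′
step⇒weak P {α = inp a} st = _ , ε , st
step⇒weak P {α = out b} st = _ , ε , st
step⇒weak P {α = τ}     st = st ◅ ε

module _ {i o s₁ t₁ s₂ t₂ : Level} {I : Set i} {O : Set o}
         {Q : IA s₁ t₁ I O} {R : IA s₂ t₂ I O} where
  private
    module Q = IA Q

  ⇒ε-left : ∀ {q q′} → _⇒ε_ Q q q′ → _⇒ε_ (Q ∨IA R) (left q) (left q′)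
  ⇒ε-left = gmap left stepP

  weak-left : ∀ {q α q′} → weak Q q α q′ → weak (Q ∨IA R) (left q) α (left q′)
  weak-left {α = inp a} (_ , path , st) = _ , ⇒ε-left path , stepP st
  weak-left {α = out b} (_ , path , st) = _ , ⇒ε-left path , stepP st
  weak-left {α = τ}     path            = ⇒ε-left path

  τ∷⇒ε-∨ˡ : ∀ {q q₁ q′ r} → q Q.—[ τ ]→ q₁ → _⇒ε_ Q q₁ q′ →
    _⇒ε_ (Q ∨IA R) (q ∨ r) (left q′)
  τ∷⇒ε-∨ˡ st path = rOT1 isτ st ◅ ⇒ε-left path

  weak-out-∨ˡ : ∀ {q b q′ r} → weak Q q (out b) q′ →
    weak (Q ∨IA R) (q ∨ r) (out b) (left q′)
  weak-out-∨ˡ (_ , ε , st)        = _ , ε , rOT1 (isOut _) st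
  weak-out-∨ˡ (_ , st₀ ◅ path , st) = _ , τ∷⇒ε-∨ˡ st₀ path , stepP st

module _ {i o s₁ t₁ s₂ t₂ s₃ t₃ ℓ : Level} {I : Set i} {O : Set o}
         {P : IA s₁ t₁ I O} {Q : IA s₂ t₂ I O} (R : IA s₃ t₃ I O)
         (𝓡 : IA.State P → IA.State Q → Set ℓ) where
  private
    module P = IA P
    module Q = IA Q
    module R = IA R

  -- Its level is padded to that of the transitions of P ∨ R and Q ∨ R, the
  -- level at which ⊑IA quantifies over simulations between them.
  data ∨-lift : ∨State P.State R.State → ∨State Q.State R.State →
                Set (i ⊔ o ⊔ s₁ ⊔ t₁ ⊔ s₂ ⊔ t₂ ⊔ s₃ ⊔ t₃ ⊔ ℓ) where
    both   : ∀ {p q r} → 𝓡 p q → ∨-lift (p ∨ r) (q ∨ r)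
    lefts  : ∀ {p q} → 𝓡 p q → ∨-lift (left p) (left q)
    left-∨ : ∀ {p q r} → 𝓡 p q → ∨-lift (left p) (q ∨ r)
    rights : ∀ {r} → ∨-lift (right r) (right r)

  answer-from-∨ : ∀ {q α q′ p′ r} → OutOrτ α → weak Q q α q′ → 𝓡 p′ q′ →
    Σ (∨State Q.State R.State) λ y′ →
      weak (Q ∨IA R) (q ∨ r) α y′ × ∨-lift (left p′) y′
  answer-from-∨ (isOut b) w          h = _ , weak-out-∨ˡ w , lefts h
  answer-from-∨ isτ       ε          h = _ , ε , left-∨ h
  answer-from-∨ isτ       (st ◅ path) h = _ , τ∷⇒ε-∨ˡ st path , lefts h

  IsAltSim-∨ʳ : IsAltSim P Q 𝓡 → IsAltSim (P ∨IA R) (Q ∨IA R) ∨-lift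
  IsAltSim-∨ʳ sim = record { inputs = inputs′ ; outputs = outputs′ }
    where
    open IsAltSim sim

    inputs′ : ∀ {x y} → ∨-lift x y → ∀ (a : I) {y′} → ∨Step Q R y (inp a) y′ →
      Σ (∨State P.State R.State) λ x′ → ∨Step P R x (inp a) x′ × ∨-lift x′ y′
    inputs′ (both h) a (rI _ st stR) with inputs h a st
    ... | _ , st′ , h′ = _ , rI a st′ stR , both h′
    inputs′ (lefts h) a (stepP st) with inputs h a st
    ... | _ , st′ , h′ = _ , stepP st′ , lefts h′
    inputs′ (left-∨ h) a (rI _ st _) with inputs h a st
    ... | _ , st′ , h′ = _ , stepP st′ , left-∨ h′
    inputs′ rights a (stepQ stR) = _ , stepQ stR , rights
    inputs′ (both _)   a (rOT1 () _)
    inputs′ (both _)   a (rOT2 () _)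
    inputs′ (left-∨ _) a (rOT1 () _)
    inputs′ (left-∨ _) a (rOT2 () _)

    outputs′ : ∀ {x y} → ∨-lift x y → ∀ {α x′} → OutOrτ α → ∨Step P R x α x′ →
      Σ (∨State Q.State R.State) λ y′ → weak (Q ∨IA R) y α y′ × ∨-lift x′ y′
    outputs′ (both h) k (rOT1 _ st) with outputs h k st
    ... | _ , w , h′ = answer-from-∨ k w h′
    outputs′ (both _) k (rOT2 _ stR) = _ , step⇒weak (Q ∨IA R) (rOT2 k stR) , rights
    outputs′ (both _) () (rI _ _ _)
    outputs′ (lefts h) k (stepP st) with outputs h k st
    ... | _ , w , h′ = _ , weak-left w , lefts h′
    outputs′ (left-∨ h) k (stepP st) with outputs h k st
    ... | _ , w , h′ = answer-from-∨ k w h′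
    outputs′ rights k (stepQ stR) = _ , step⇒weak (Q ∨IA R) (stepQ stR) , rights

corollary2p8 : {i o s₁ t₁ s₂ t₂ s₃ t₃ : Level} {I : Set i} {O : Set o}
    (P : IA s₁ t₁ I O) (Q : IA s₂ t₂ I O) (R : IA s₃ t₃ I O)
    (p : IA.State P) (q : IA.State Q) (r : IA.State R) →
    ⊑IA P Q p q →
    ⊑IA (P ∨IA R) (Q ∨IA R) (p ∨ r) (q ∨ r)
corollary2p8 P Q R p q r (𝓡 , sim , p⊑q) =
  ∨-lift R 𝓡 , IsAltSim-∨ʳ R 𝓡 sim , both p⊑q
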